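{- Let $G=(V,E)$ be a graph, let $u,v\in V$ with $u\ne v$ and $N(u)=N(v)$. Then $$\mathrm{ID}(G,x)=\mathrm{ID}(G-v,x)+(x^2-x)\,\mathrm{ID}(G-N[v]-u,x).$$
   Context: All graphs are finite, simple and undirected. $N(v)$ is the open neighborhood of $v$ and $N[v]=N(v)\cup\{v\}$. $G-v$ deletes $v$ and its incident edges. $G-N[v]-u$ deletes all vertices of $N[v]\cup\{u\}$; if no vertices remain, $\mathrm{ID}$ of the resulting graph is $1$. A set $W\subseteq V$ is an independent dominating set of $G=(V,E)$ if every vertex of $V\setminus W$ is adjacent to at least one vertex of $W$ and no two vertices of $W$ are adjacent. The independent domination polynomial is $\mathrm{ID}(G,x)=\sum_{W}x^{|W|}$, the sum over all independent dominating sets $W$ of $G$. -}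

module Defs where

open import Data.Bool using (Bool; true; false; _∧_; _∨_; not; if_then_else_)
open import Data.Nat using (ℕ; zero; suc)
open import Data.Fin using (Fin; zero; suc)
open import Data.Fin.Subset using (Subset; ⁅_⁆; _∈_; ∣_∣) renaming (⊥ to ∅; ⊤ to full)
open import Data.Vec using (Vec; []; _∷_; lookup; tabulate)
open import Data.List using (List; []; _∷_; map; _++_; foldr; allFin)
open import Data.Integer using (ℤ; _+_; _*_; _^_) renaming (0ℤ to zeroℤ)
open import Relation.Binary.PropositionalEquality using (_≡_)

record Graph (n : ℕ) : Set where
  field
    adj   : Fin n → Fin n → Bool
    sym   : ∀ u v → adj u v ≡ adj v u
    irrefl : ∀ v → adj v v ≡ false
open Graph public

allᵇ : {n : ℕ} → (Fin n → Bool) → Bool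
allᵇ p = foldr (λ i b → p i ∧ b) true (allFin _)

anyᵇ : {n : ℕ} → (Fin n → Bool) → Bool
anyᵇ p = foldr (λ i b → p i ∨ b) false (allFin _)

memᵇ : {n : ℕ} → Subset n → Fin n → Bool
memᵇ S i = lookup S i

-- Vertex subsets: sets S ⊆ V represent induced subgraphs G[S].
-- Set difference with the vertices satisfying a predicate.
removeᵇ : {n : ℕ} → Subset n → (Fin n → Bool) → Subset n
removeᵇ S p = tabulate (λ i → memᵇ S i ∧ not (p i))

_==ᶠ_ : {n : ℕ} → Fin n → Fin n → Bool
zero ==ᶠ zero = true
zero ==ᶠ suc _ = false
suc _ ==ᶠ zero = false
suc a ==ᶠ suc b = a ==ᶠ b

deleteV : {n : ℕ} → Subset n → Fin n → Subset n
deleteV S v = removeᵇ S (λ w → w ==ᶠ v)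

deleteNbV : {n : ℕ} → Graph n → Subset n → Fin n → Fin n → Subset n
deleteNbV G S v u = removeᵇ S (λ w → adj G v w ∨ (w ==ᶠ v) ∨ (w ==ᶠ u))

isIDSᵇ : {n : ℕ} → Graph n → Subset n → Subset n → Bool
isIDSᵇ G S W =
  allᵇ (λ w → not (memᵇ W w) ∨ memᵇ S w)
  ∧ allᵇ (λ a → allᵇ (λ b → not (memᵇ W a ∧ memᵇ W b ∧ adj G a b)))
  ∧ allᵇ (λ a → not (memᵇ S a) ∨ memᵇ W a
                 ∨ anyᵇ (λ b → memᵇ W b ∧ adj G a b))

allSubsets : (n : ℕ) → List (Subset n)
allSubsets zero = [] ∷ []
allSubsets (suc n) = map (true ∷_) (allSubsets n) ++ map (false ∷_) (allSubsets n)

sumℤ : List ℤ → ℤ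
sumℤ = foldr _+_ zeroℤ

ID : {n : ℕ} → Graph n → Subset n → ℤ → ℤ
ID {n} G S x =
  sumℤ (map (λ W → if isIDSᵇ G S W then x ^ ∣ W ∣ else zeroℤ) (allSubsets n))

module Submission where

-- The proof works pointwise over the subsets W ⊆ V.  After reflecting the
-- Boolean test isIDSᵇ of Defs into a propositional record IsIDS (on vertex
-- sets given as characteristic functions), three general facts about
-- independent dominating sets carry the combinatorics:
--   * pick:        W ∋ u is an IDS of G[S]  ⇔  W ∖ {u} is an IDS of G[S ∖ N[u]];
--   * twin-forced: an IDS of G[S] containing v contains its twin u ∈ S;
--   * drop-twin:   if u, v ∉ W and u ∈ S, then W is an IDS of G[S] ⇔ of G[S ∖ {v}].
-- Splitting on whether u, v ∈ W, they show that the W-terms of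
--   ID(G) + x · ID(H)   and   ID(G - v) + x² · ID(H)       (H = G - N[v] - u)
-- agree, where the H-terms are indexed by W ∖ {u} (resp. W ∖ {v, u}) for W
-- containing u (resp. u and v).  A reindexing lemma for sums over all
-- subsets (Σˢ-withVertex) turns these shifted sums back into x·ID(H) and
-- x²·ID(H); cancelling x · ID(H) gives the theorem.

open import Defs
open import Data.Nat using (ℕ)
open import Data.Fin using (Fin)
open import Data.Fin.Subset using () renaming (⊤ to full)
open import Data.Integer using (ℤ; _+_; _-_; _*_; _^_)
open import Relation.Binary.PropositionalEquality using (_≡_)
open import Relation.Nullary using (¬_)

open import Level using (0ℓ)
open import Data.Bool using (Bool; true; false; _∧_; _∨_; not; if_then_else_)
open import Data.Bool.Properties using (∧-identityʳ; ∧-zeroʳ; ∨-conicalˡ; ∨-conicalʳ)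
import Data.Nat as ℕ
open import Data.Fin using (zero; suc)
open import Data.Fin.Properties using (_≟_)
open import Data.Fin.Subset using (Subset; ∣_∣)
open import Data.Vec using (_∷_; lookup; _[_]≔_)
open import Data.Vec.Properties using (lookup-replicate; lookup∘tabulate; lookup∘update; lookup∘update′)
open import Data.List using (List; []; _∷_; map; _++_; foldr)
import Data.List as List
open import Data.List.Properties using (map-++; map-cong; map-∘)
open import Data.Product using (∃; ∃-syntax; _×_; _,_; proj₁; proj₂)
open import Data.Sum using (_⊎_; inj₁; inj₂; [_,_])
open import Data.Empty using (⊥; ⊥-elim)
open import Data.Integer using (-_; 1ℤ; 0ℤ)
import Data.Integer.Properties as ℤ
open import Data.Integer.Tactic.RingSolver using (solve-∀)
open import Function using (_∘_; id)
open import Function.Bundles using (_⇔_; mk⇔; Equivalence)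
import Function.Properties.Equivalence as ⇔
open import Relation.Binary.PropositionalEquality
  using (refl; trans; cong; cong₂; _≗_; _≢_; ≢-sym; module ≡-Reasoning)
import Relation.Binary.PropositionalEquality as ≡
open import Relation.Nullary using (yes; no)
import Relation.Binary.Reasoning.Setoid as SetoidReasoning

open Equivalence using (to; from)

module ⇔-Reasoning = SetoidReasoning (⇔.⇔-setoid 0ℓ)

clash : ∀ {b} → b ≡ true → b ≡ false → ⊥
clash refl ()

bool-ext : ∀ {x y} → x ≡ true ⇔ y ≡ true → x ≡ y
bool-ext {true}  e = ≡.sym (to e refl)
bool-ext {false} {true} e = from e refl
bool-ext {false} {false} e = refl

∧-true : ∀ {x y} → x ∧ y ≡ true ⇔ (x ≡ true × y ≡ true)
∧-true {true}  = mk⇔ (refl ,_) proj₂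
∧-true {false} = mk⇔ (λ ()) (λ { (() , _) })

∨-true : ∀ {x y} → x ∨ y ≡ true ⇔ (x ≡ true ⊎ y ≡ true)
∨-true {true}  = mk⇔ inj₁ (λ _ → refl)
∨-true {false} = mk⇔ inj₂ [ (λ ()) , id ]

∨-false : ∀ {x y} → x ≡ false → y ≡ false → x ∨ y ≡ false
∨-false refl refl = refl

implies-true : ∀ {x y} → not x ∨ y ≡ true ⇔ (x ≡ true → y ≡ true)
implies-true {true}  = mk⇔ (λ h _ → h) (λ f → f refl)
implies-true {false} = mk⇔ (λ _ ()) (λ _ → refl)

nand-true : ∀ {x y z} → not (x ∧ y ∧ z) ≡ true ⇔ (x ≡ true → y ≡ true → z ≡ false)
nand-true {true}  {true}  {true}  = mk⇔ (λ ()) (λ f → ≡.sym (f refl refl))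
nand-true {true}  {true}  {false} = mk⇔ (λ _ _ _ → refl) (λ _ → refl)
nand-true {true}  {false}         = mk⇔ (λ _ _ ()) (λ _ → refl)
nand-true {false}                 = mk⇔ (λ _ ()) (λ _ → refl)

covered-true : ∀ {x y z} {Z : Set} → z ≡ true ⇔ Z →
               not x ∨ y ∨ z ≡ true ⇔ (x ≡ true → y ≡ false → Z)
covered-true {true}  {true}  e = mk⇔ (λ _ _ ()) (λ _ → refl)
covered-true {true}  {false} e = mk⇔ (λ h _ _ → to e h) (λ f → from e (f refl refl))
covered-true {false}         e = mk⇔ (λ _ ()) (λ _ → refl)

all-tabulate : ∀ {n m} (p : Fin m → Bool) (f : Fin n → Fin m) →
  foldr (λ i b → p i ∧ b) true (List.tabulate f) ≡ true ⇔ (∀ j → p (f j) ≡ true)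
all-tabulate {ℕ.zero}  p f = mk⇔ (λ _ ()) (λ _ → refl)
all-tabulate {ℕ.suc n} p f = mk⇔
  (λ h → let (h₀ , hs) = to ∧-true h in
         λ { zero → h₀ ; (suc j) → to (all-tabulate p (f ∘ suc)) hs j })
  (λ h → from ∧-true (h zero , from (all-tabulate p (f ∘ suc)) (h ∘ suc)))

any-tabulate : ∀ {n m} (p : Fin m → Bool) (f : Fin n → Fin m) →
  foldr (λ i b → p i ∨ b) false (List.tabulate f) ≡ true ⇔ (∃[ j ] p (f j) ≡ true)
any-tabulate {ℕ.zero}  p f = mk⇔ (λ ()) (λ { (() , _) })
any-tabulate {ℕ.suc n} p f = mk⇔
  ([ (zero ,_) , (λ hs → let (j , q) = to (any-tabulate p (f ∘ suc)) hs in suc j , q) ]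
     ∘ to ∨-true)
  (λ { (zero , q)  → from ∨-true (inj₁ q)
     ; (suc j , q) → from ∨-true (inj₂ (from (any-tabulate p (f ∘ suc)) (j , q))) })

allᵇ-spec : ∀ {n} {p : Fin n → Bool} {P : Fin n → Set} →
  (∀ i → p i ≡ true ⇔ P i) → allᵇ p ≡ true ⇔ (∀ i → P i)
allᵇ-spec {p = p} e = mk⇔
  (λ h i → to (e i) (to (all-tabulate p id) h i))
  (λ h → from (all-tabulate p id) (λ i → from (e i) (h i)))

anyᵇ-spec : ∀ {n} {p : Fin n → Bool} {P : Fin n → Set} →
  (∀ i → p i ≡ true ⇔ P i) → anyᵇ p ≡ true ⇔ ∃ P
anyᵇ-spec {p = p} e = mk⇔
  (λ h → let (i , q) = to (any-tabulate p id) h in i , to (e i) q)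
  (λ { (i , q) → from (any-tabulate p id) (i , from (e i) q) })

VSet : ℕ → Set
VSet n = Fin n → Bool

everything : ∀ {n} → VSet n
everything _ = true

_─_ : ∀ {n} → VSet n → VSet n → VSet n
(s ─ p) a = s a ∧ not (p a)

⦅_⦆ : ∀ {n} → Fin n → VSet n
⦅ b ⦆ a = a ==ᶠ b

closedNbhd : ∀ {n} → Graph n → Fin n → VSet n
closedNbhd G u a = adj G u a ∨ (a ==ᶠ u)

==ᶠ-sound : ∀ {n} {a b : Fin n} → (a ==ᶠ b) ≡ true → a ≡ b
==ᶠ-sound {a = zero}  {zero}  _ = refl
==ᶠ-sound {a = suc a} {suc b} h = cong suc (==ᶠ-sound h)

==ᶠ-refl : ∀ {n} (a : Fin n) → (a ==ᶠ a) ≡ true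
==ᶠ-refl zero    = refl
==ᶠ-refl (suc a) = ==ᶠ-refl a

==ᶠ-false : ∀ {n} {a b : Fin n} → a ≢ b → (a ==ᶠ b) ≡ false
==ᶠ-false {a = a} {b} a≢b with a ==ᶠ b in e
... | true  = ⊥-elim (a≢b (==ᶠ-sound e))
... | false = refl

distinct : ∀ {n} (f : VSet n) {a b} → f a ≡ true → f b ≡ false → a ≢ b
distinct f fa fb refl = clash fa fb

─-keep : ∀ {n} {s p : VSet n} {a} → p a ≡ false → (s ─ p) a ≡ s a
─-keep {s = s} {a = a} pa = trans (cong (λ b → s a ∧ not b) pa) (∧-identityʳ (s a))

─-drop : ∀ {n} {s p : VSet n} {a} → p a ≡ true → (s ─ p) a ≡ false
─-drop {s = s} {a = a} pa = trans (cong (λ b → s a ∧ not b) pa) (∧-zeroʳ (s a))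

─-intro : ∀ {n} {s p : VSet n} {a} → s a ≡ true → p a ≡ false → (s ─ p) a ≡ true
─-intro {s = s} {p} sa pa = trans (─-keep {s = s} {p} pa) sa

─-elim : ∀ {n} {s p : VSet n} {a} → (s ─ p) a ≡ true → s a ≡ true × p a ≡ false
─-elim {s = s} {p} {a} = go (s a) (p a)
  where
  go : ∀ x y → x ∧ not y ≡ true → x ≡ true × y ≡ false
  go true false _ = refl , refl
  go true true ()
  go false _   ()

removeᵇ-full : ∀ {n} (p : VSet n) → lookup (removeᵇ full p) ≗ everything ─ p
removeᵇ-full p a =
  trans (lookup∘tabulate _ a) (cong (λ b → b ∧ not (p a)) (lookup-replicate a true))

remove-lookup : ∀ {n} (W : Subset n) i → lookup (W [ i ]≔ false) ≗ lookup W ─ ⦅ i ⦆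
remove-lookup W i a with a ≟ i
... | yes refl = trans (lookup∘update a W false) (≡.sym (─-drop {s = lookup W} {⦅ a ⦆} (==ᶠ-refl a)))
... | no a≢i   =
  trans (lookup∘update′ a≢i W false) (≡.sym (─-keep {s = lookup W} {⦅ i ⦆} (==ᶠ-false a≢i)))

card-remove : ∀ {n} (W : Subset n) i → lookup W i ≡ true → ∣ W ∣ ≡ ℕ.suc ∣ W [ i ]≔ false ∣
card-remove (true ∷ W)  zero    _ = refl
card-remove (true ∷ W)  (suc i) h = cong ℕ.suc (card-remove W i h)
card-remove (false ∷ W) (suc i) h = card-remove W i h

record IsIDS {n} (G : Graph n) (s w : VSet n) : Set where
  field
    inside      : ∀ a → w a ≡ true → s a ≡ true
    independent : ∀ a b → w a ≡ true → w b ≡ true → adj G a b ≡ false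
    dominating  : ∀ a → s a ≡ true → w a ≡ false → ∃[ b ] (w b ≡ true × adj G a b ≡ true)
open IsIDS

isIDSᵇ-spec : ∀ {n} (G : Graph n) (S W : Subset n) →
  isIDSᵇ G S W ≡ true ⇔ IsIDS G (lookup S) (lookup W)
isIDSᵇ-spec G S W = mk⇔
  (λ h → let (h₁ , h₂₃) = to ∧-true h ; (h₂ , h₃) = to ∧-true h₂₃ in record
    { inside = to insideᵇ h₁ ; independent = to independentᵇ h₂ ; dominating = to dominatingᵇ h₃ })
  (λ P → from ∧-true (from insideᵇ (inside P) ,
         from ∧-true (from independentᵇ (independent P) , from dominatingᵇ (dominating P))))
  where
  insideᵇ : allᵇ (λ a → not (lookup W a) ∨ lookup S a) ≡ true ⇔
            (∀ a → lookup W a ≡ true → lookup S a ≡ true)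
  insideᵇ = allᵇ-spec (λ a → implies-true)

  independentᵇ : allᵇ (λ a → allᵇ (λ b → not (lookup W a ∧ lookup W b ∧ adj G a b))) ≡ true ⇔
                 (∀ a b → lookup W a ≡ true → lookup W b ≡ true → adj G a b ≡ false)
  independentᵇ = allᵇ-spec (λ a → allᵇ-spec (λ b → nand-true))

  dominatingᵇ :
    allᵇ (λ a → not (lookup S a) ∨ lookup W a ∨ anyᵇ (λ b → lookup W b ∧ adj G a b)) ≡ true ⇔
    (∀ a → lookup S a ≡ true → lookup W a ≡ false → ∃[ b ] (lookup W b ≡ true × adj G a b ≡ true))
  dominatingᵇ = allᵇ-spec (λ a → covered-true (anyᵇ-spec (λ b → ∧-true)))

isIDSᵇ-resp : ∀ {n} (G : Graph n) {S W S' W' : Subset n} →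
  IsIDS G (lookup S) (lookup W) ⇔ IsIDS G (lookup S') (lookup W') →
  isIDSᵇ G S W ≡ isIDSᵇ G S' W'
isIDSᵇ-resp G {S} {W} {S'} {W'} e =
  bool-ext (⇔.trans (isIDSᵇ-spec G S W) (⇔.trans e (⇔.sym (isIDSᵇ-spec G S' W'))))

isIDSᵇ-false : ∀ {n} (G : Graph n) {S W : Subset n} →
  ¬ IsIDS G (lookup S) (lookup W) → isIDSᵇ G S W ≡ false
isIDSᵇ-false G {S} {W} ¬P with isIDSᵇ G S W in e
... | true  = ⊥-elim (¬P (to (isIDSᵇ-spec G S W) e))
... | false = refl

IsIDS-transport : ∀ {n} (G : Graph n) {s s' w w' : VSet n} → s ≗ s' → w ≗ w' →
  IsIDS G s w → IsIDS G s' w'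
IsIDS-transport G s≗ w≗ P = record
  { inside      = λ a wa → trans (≡.sym (s≗ a)) (inside P a (trans (w≗ a) wa))
  ; independent = λ a b wa wb → independent P a b (trans (w≗ a) wa) (trans (w≗ b) wb)
  ; dominating  = λ a sa wa →
      let (b , wb , ab) = dominating P a (trans (s≗ a) sa) (trans (w≗ a) wa)
      in b , trans (≡.sym (w≗ b)) wb , ab
  }

IsIDS-resp : ∀ {n} (G : Graph n) {s s' w w' : VSet n} → s ≗ s' → w ≗ w' →
  IsIDS G s w ⇔ IsIDS G s' w'
IsIDS-resp G s≗ w≗ =
  mk⇔ (IsIDS-transport G s≗ w≗) (IsIDS-transport G (≡.sym ∘ s≗) (≡.sym ∘ w≗))

-- A set containing u is an IDS of G[s] iff removing u from it leaves an IDS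
-- of G[s ∖ N[u]]: u dominates exactly N[u], and independence keeps the rest
-- of the set out of N[u].
pick : ∀ {n} (G : Graph n) {s w : VSet n} {u : Fin n} → s u ≡ true → w u ≡ true →
  IsIDS G s w ⇔ IsIDS G (s ─ closedNbhd G u) (w ─ ⦅ u ⦆)
pick G {s} {w} {u} su wu = mk⇔ shrink grow
  where
  kept : ∀ {a} → a ≢ u → (w ─ ⦅ u ⦆) a ≡ w a
  kept a≢u = ─-keep {s = w} {⦅ u ⦆} (==ᶠ-false a≢u)

  w∖u-elim : ∀ {a} → (w ─ ⦅ u ⦆) a ≡ true → w a ≡ true × (a ==ᶠ u) ≡ false
  w∖u-elim = ─-elim {s = w} {⦅ u ⦆}

  s∖N[u]-elim : ∀ {a} → (s ─ closedNbhd G u) a ≡ true → s a ≡ true × closedNbhd G u a ≡ false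
  s∖N[u]-elim = ─-elim {s = s} {closedNbhd G u}

  s∖N[u]-intro : ∀ {a} → s a ≡ true → closedNbhd G u a ≡ false → (s ─ closedNbhd G u) a ≡ true
  s∖N[u]-intro = ─-intro {s = s} {closedNbhd G u}

  shrink : IsIDS G s w → IsIDS G (s ─ closedNbhd G u) (w ─ ⦅ u ⦆)
  shrink P = record
    { inside      = λ a h → let (wa , a≉u) = w∖u-elim h in
                    s∖N[u]-intro (inside P a wa) (∨-false (independent P u a wu wa) a≉u)
    ; independent = λ a b ha hb → independent P a b (proj₁ (w∖u-elim ha)) (proj₁ (w∖u-elim hb))
    ; dominating  = dom }
    where
    dom : ∀ a → (s ─ closedNbhd G u) a ≡ true → (w ─ ⦅ u ⦆) a ≡ false →
          ∃[ b ] ((w ─ ⦅ u ⦆) b ≡ true × adj G a b ≡ true)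
    dom a h w'a with s∖N[u]-elim h
    ... | sa , a∉N[u]
        with dominating P a sa (trans (≡.sym (─-keep {s = w} {⦅ u ⦆} (∨-conicalʳ _ _ a∉N[u]))) w'a)
    ... | b , wb , ab = b , trans (kept b≢u) wb , ab
      where
      b≢u : b ≢ u
      b≢u refl = clash (trans (Graph.sym G u a) ab) (∨-conicalˡ _ _ a∉N[u])

  grow : IsIDS G (s ─ closedNbhd G u) (w ─ ⦅ u ⦆) → IsIDS G s w
  grow P = record { inside = ins ; independent = ind ; dominating = dom }
    where
    far : ∀ b → b ≢ u → w b ≡ true → adj G u b ≡ false
    far b b≢u wb = ∨-conicalˡ _ _ (proj₂ (s∖N[u]-elim (inside P b (trans (kept b≢u) wb))))

    ins : ∀ a → w a ≡ true → s a ≡ true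
    ins a wa with a ≟ u
    ... | yes refl = su
    ... | no a≢u   = proj₁ (s∖N[u]-elim (inside P a (trans (kept a≢u) wa)))

    ind : ∀ a b → w a ≡ true → w b ≡ true → adj G a b ≡ false
    ind a b wa wb with a ≟ u | b ≟ u
    ... | yes refl | yes refl = irrefl G u
    ... | yes refl | no b≢u   = far b b≢u wb
    ... | no a≢u   | yes refl = trans (Graph.sym G a u) (far a a≢u wa)
    ... | no a≢u   | no b≢u   = independent P a b (trans (kept a≢u) wa) (trans (kept b≢u) wb)

    dom : ∀ a → s a ≡ true → w a ≡ false → ∃[ b ] (w b ≡ true × adj G a b ≡ true)
    dom a sa wa with adj G u a in ua
    ... | true  = u , wu , trans (Graph.sym G a u) ua
    ... | false with dominating P a (s∖N[u]-intro sa (∨-false ua (==ᶠ-false (≢-sym (distinct w wu wa)))))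
                                    (trans (kept (≢-sym (distinct w wu wa))) wa)
    ... | b , w'b , ab = b , proj₁ (w∖u-elim w'b) , ab

-- If N(u) = N(v) and u ∈ s, every IDS of G[s] containing v also contains u:
-- otherwise u would be dominated by a neighbour of v in the set.
twin-forced : ∀ {n} (G : Graph n) {s w : VSet n} {u v : Fin n} →
  (∀ a → adj G u a ≡ adj G v a) → IsIDS G s w → s u ≡ true → w v ≡ true → w u ≡ true
twin-forced G {w = w} {u} {v} twin P su wv with w u in wu
... | true  = refl
... | false with dominating P u su wu
... | b , wb , ub = ⊥-elim (clash (trans (≡.sym (twin b)) ub) (independent P v b wv wb))

-- If N(u) = N(v), u ≠ v, u ∈ s and neither twin is in w, then deleting v
-- does not affect whether w is an IDS: v is dominated iff u is.
drop-twin : ∀ {n} (G : Graph n) {s w : VSet n} {u v : Fin n} →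
  (∀ a → adj G u a ≡ adj G v a) → u ≢ v → s u ≡ true → w u ≡ false → w v ≡ false →
  IsIDS G s w ⇔ IsIDS G (s ─ ⦅ v ⦆) w
drop-twin G {s} {w} {u} {v} twin u≢v su wu wv = mk⇔ shrink grow
  where
  s∖v-intro : ∀ {a} → s a ≡ true → a ≢ v → (s ─ ⦅ v ⦆) a ≡ true
  s∖v-intro sa a≢v = ─-intro {s = s} {⦅ v ⦆} sa (==ᶠ-false a≢v)

  s∖v-sub : ∀ {a} → (s ─ ⦅ v ⦆) a ≡ true → s a ≡ true
  s∖v-sub = proj₁ ∘ ─-elim {s = s} {⦅ v ⦆}

  shrink : IsIDS G s w → IsIDS G (s ─ ⦅ v ⦆) w
  shrink P = record
    { inside      = λ a wa → s∖v-intro (inside P a wa) (distinct w wa wv)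
    ; independent = independent P
    ; dominating  = λ a h → dominating P a (s∖v-sub h) }

  grow : IsIDS G (s ─ ⦅ v ⦆) w → IsIDS G s w
  grow P = record
    { inside = λ a wa → s∖v-sub (inside P a wa) ; independent = independent P ; dominating = dom }
    where
    dom : ∀ a → s a ≡ true → w a ≡ false → ∃[ b ] (w b ≡ true × adj G a b ≡ true)
    dom a sa wa with a ≟ v
    ... | no a≢v   = dominating P a (s∖v-intro sa a≢v) wa
    ... | yes refl with dominating P u (s∖v-intro su u≢v) wu
    ... | b , wb , ub = b , wb , trans (≡.sym (twin b)) ub

sumℤ-++ : ∀ (xs ys : List ℤ) → sumℤ (xs ++ ys) ≡ sumℤ xs + sumℤ ys
sumℤ-++ []       ys = ≡.sym (ℤ.+-identityˡ _)
sumℤ-++ (x ∷ xs) ys = trans (cong (x +_) (sumℤ-++ xs ys)) (≡.sym (ℤ.+-assoc x _ _))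

sum-map-+ : ∀ {A : Set} (f g : A → ℤ) xs →
  sumℤ (map (λ a → f a + g a) xs) ≡ sumℤ (map f xs) + sumℤ (map g xs)
sum-map-+ f g []       = refl
sum-map-+ f g (a ∷ xs) =
  trans (cong (f a + g a +_) (sum-map-+ f g xs)) (interchange (f a) (g a) _ _)
  where
  interchange : ∀ (a b c d : ℤ) → (a + b) + (c + d) ≡ (a + c) + (b + d)
  interchange = solve-∀

sum-map-scale : ∀ {A : Set} (c : ℤ) (f : A → ℤ) xs →
  sumℤ (map (λ a → c * f a) xs) ≡ c * sumℤ (map f xs)
sum-map-scale c f []       = ≡.sym (ℤ.*-zeroʳ c)
sum-map-scale c f (a ∷ xs) =
  trans (cong (c * f a +_) (sum-map-scale c f xs)) (≡.sym (ℤ.*-distribˡ-+ c (f a) _))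

Σˢ : ∀ {n} → (Subset n → ℤ) → ℤ
Σˢ {n} f = sumℤ (map f (allSubsets n))

Σˢ-cong : ∀ {n} {f g : Subset n → ℤ} → f ≗ g → Σˢ f ≡ Σˢ g
Σˢ-cong {n} e = cong sumℤ (map-cong e (allSubsets n))

Σˢ-split : ∀ {m} (f : Subset (ℕ.suc m) → ℤ) →
  Σˢ f ≡ Σˢ (f ∘ (true ∷_)) + Σˢ (f ∘ (false ∷_))
Σˢ-split {m} f = begin
  sumℤ (map f (map (true ∷_) Ss ++ map (false ∷_) Ss))
    ≡⟨ cong sumℤ (map-++ f (map (true ∷_) Ss) (map (false ∷_) Ss)) ⟩
  sumℤ (map f (map (true ∷_) Ss) ++ map f (map (false ∷_) Ss))
    ≡⟨ sumℤ-++ (map f (map (true ∷_) Ss)) (map f (map (false ∷_) Ss)) ⟩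
  sumℤ (map f (map (true ∷_) Ss)) + sumℤ (map f (map (false ∷_) Ss))
    ≡⟨ ≡.sym (cong₂ _+_ (cong sumℤ (map-∘ Ss)) (cong sumℤ (map-∘ Ss))) ⟩
  Σˢ (f ∘ (true ∷_)) + Σˢ (f ∘ (false ∷_)) ∎
  where
  open ≡-Reasoning
  Ss = allSubsets m

withVertex : ∀ {n} → Fin n → (Subset n → ℤ) → Subset n → ℤ
withVertex i h W = if lookup W i then h (W [ i ]≔ false) else 0ℤ

withVertex-in : ∀ {n} (i : Fin n) h W → lookup W i ≡ true → withVertex i h W ≡ h (W [ i ]≔ false)
withVertex-in i h W e = cong (λ b → if b then h (W [ i ]≔ false) else 0ℤ) e

withVertex-out : ∀ {n} (i : Fin n) h W → lookup W i ≡ false → withVertex i h W ≡ 0ℤ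
withVertex-out i h W e = cong (λ b → if b then h (W [ i ]≔ false) else 0ℤ) e

-- W ↦ W ∖ {i} is a bijection from the sets containing i onto those avoiding
-- it; so if h vanishes on the sets containing i, reindexing preserves the sum.
Σˢ-withVertex : ∀ {n} (i : Fin n) (h : Subset n → ℤ) →
  (∀ W → lookup W i ≡ true → h W ≡ 0ℤ) → Σˢ (withVertex i h) ≡ Σˢ h
Σˢ-withVertex {ℕ.suc m} zero h h0 = begin
  Σˢ (withVertex zero h)
    ≡⟨ Σˢ-split (withVertex zero h) ⟩
  Σˢ (h ∘ (false ∷_)) + Σˢ {m} (λ _ → 0ℤ)
    ≡⟨ ℤ.+-comm (Σˢ (h ∘ (false ∷_))) _ ⟩
  Σˢ {m} (λ _ → 0ℤ) + Σˢ (h ∘ (false ∷_))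
    ≡⟨ cong (_+ Σˢ (h ∘ (false ∷_))) (Σˢ-cong (λ W → ≡.sym (h0 (true ∷ W) refl))) ⟩
  Σˢ (h ∘ (true ∷_)) + Σˢ (h ∘ (false ∷_))
    ≡⟨ ≡.sym (Σˢ-split h) ⟩
  Σˢ h ∎
  where open ≡-Reasoning
Σˢ-withVertex {ℕ.suc m} (suc j) h h0 = begin
  Σˢ (withVertex (suc j) h)
    ≡⟨ Σˢ-split (withVertex (suc j) h) ⟩
  Σˢ (withVertex j (h ∘ (true ∷_))) + Σˢ (withVertex j (h ∘ (false ∷_)))
    ≡⟨ cong₂ _+_ (Σˢ-withVertex j _ (λ W → h0 (true ∷ W))) (Σˢ-withVertex j _ (λ W → h0 (false ∷ W))) ⟩
  Σˢ (h ∘ (true ∷_)) + Σˢ (h ∘ (false ∷_))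
    ≡⟨ ≡.sym (Σˢ-split h) ⟩
  Σˢ h ∎
  where open ≡-Reasoning

term : ∀ {n} → Graph n → ℤ → Subset n → Subset n → ℤ
term G x S W = if isIDSᵇ G S W then x ^ ∣ W ∣ else 0ℤ

term-vanish : ∀ {n} (G : Graph n) x (S W : Subset n) →
  ¬ IsIDS G (lookup S) (lookup W) → term G x S W ≡ 0ℤ
term-vanish G x S W ¬P = cong (λ b → if b then x ^ ∣ W ∣ else 0ℤ) (isIDSᵇ-false G {S} {W} ¬P)

term-outside : ∀ {n} (G : Graph n) x (S W : Subset n) i →
  lookup W i ≡ true → lookup S i ≡ false → term G x S W ≡ 0ℤ
term-outside G x S W i wi si = term-vanish G x S W (λ P → clash (inside P i wi) si)

scaled-outside : ∀ {n} (G : Graph n) x c (S W : Subset n) i →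
  lookup W i ≡ true → lookup S i ≡ false → c * term G x S W ≡ 0ℤ
scaled-outside G x c S W i wi si = trans (cong (c *_) (term-outside G x S W i wi si)) (ℤ.*-zeroʳ c)

term-resp : ∀ {n} (G : Graph n) x {S S' W : Subset n} →
  IsIDS G (lookup S) (lookup W) ⇔ IsIDS G (lookup S') (lookup W) → term G x S W ≡ term G x S' W
term-resp G x {S} {S'} {W} e = cong (λ b → if b then x ^ ∣ W ∣ else 0ℤ) (isIDSᵇ-resp G {S} {W} {S'} {W} e)

term-transfer : ∀ {n} (G : Graph n) x k {S S' W W' : Subset n} →
  IsIDS G (lookup S) (lookup W) ⇔ IsIDS G (lookup S') (lookup W') →
  ∣ W ∣ ≡ k ℕ.+ ∣ W' ∣ → term G x S W ≡ x ^ k * term G x S' W'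
term-transfer G x k {S} {S'} {W} {W'} e size = begin
  term G x S W
    ≡⟨ cong (λ b → if b then x ^ ∣ W ∣ else 0ℤ) (isIDSᵇ-resp G {S} {W} {S'} {W'} e) ⟩
  (if isIDSᵇ G S' W' then x ^ ∣ W ∣ else 0ℤ)
    ≡⟨ cong (λ m → if isIDSᵇ G S' W' then x ^ m else 0ℤ) size ⟩
  (if isIDSᵇ G S' W' then x ^ (k ℕ.+ ∣ W' ∣) else 0ℤ)
    ≡⟨ factor (isIDSᵇ G S' W') ⟩
  x ^ k * term G x S' W' ∎
  where
  open ≡-Reasoning
  factor : ∀ b → (if b then x ^ (k ℕ.+ ∣ W' ∣) else 0ℤ) ≡ x ^ k * (if b then x ^ ∣ W' ∣ else 0ℤ)
  factor true  = ℤ.^-distribˡ-+-* x k ∣ W' ∣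
  factor false = ≡.sym (ℤ.*-zeroʳ (x ^ k))

-- Removing two overlapping sets one after the other, as Boolean identities:
-- with p = "a ∈ N(v)", q = "a = v", r = "a = u" they say that deleting N[v]
-- (resp. v) and then N[u] = N(v) ∪ {u} deletes exactly N[v] ∪ {u}.
nor-merge : ∀ p q r → not (p ∨ q) ∧ not (p ∨ r) ≡ not (p ∨ q ∨ r)
nor-merge true  q     r = refl
nor-merge false true  r = refl
nor-merge false false r = refl

nor-merge′ : ∀ p q r → not q ∧ not (p ∨ r) ≡ not (p ∨ q ∨ r)
nor-merge′ true  true  r = refl
nor-merge′ true  false r = refl
nor-merge′ false true  r = refl
nor-merge′ false false r = refl

module TwinRecurrence {n} (G : Graph n) {u v : Fin n} (u≢v : u ≢ v)
                      (twin : ∀ a → adj G u a ≡ adj G v a) where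

  V∖v V∖N[v]∖u : Subset n
  V∖v = deleteV full v
  V∖N[v]∖u = deleteNbV G full v u

  removed : VSet n
  removed a = adj G v a ∨ (a ==ᶠ v) ∨ (a ==ᶠ u)

  full≗ : lookup (full {n}) ≗ everything
  full≗ a = lookup-replicate a true

  adj-vu : adj G v u ≡ false
  adj-vu = trans (≡.sym (twin u)) (irrefl G u)

  v∉V∖v : lookup V∖v v ≡ false
  v∉V∖v = trans (removeᵇ-full ⦅ v ⦆ v) (─-drop {s = everything} {⦅ v ⦆} {v} (==ᶠ-refl v))

  v∉V∖N[v]∖u : lookup V∖N[v]∖u v ≡ false
  v∉V∖N[v]∖u rewrite removeᵇ-full removed v | irrefl G v | ==ᶠ-refl v = refl

  u∉V∖N[v]∖u : lookup V∖N[v]∖u u ≡ false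
  u∉V∖N[v]∖u rewrite removeᵇ-full removed u | adj-vu | ==ᶠ-false u≢v | ==ᶠ-refl u = refl

  after-both : (everything ─ closedNbhd G v) ─ closedNbhd G u ≗ lookup V∖N[v]∖u
  after-both a = trans (cong (λ t → not (adj G v a ∨ (a ==ᶠ v)) ∧ not (t ∨ (a ==ᶠ u))) (twin a))
                       (trans (nor-merge (adj G v a) (a ==ᶠ v) (a ==ᶠ u)) (≡.sym (removeᵇ-full removed a)))

  after-v : (everything ─ ⦅ v ⦆) ─ closedNbhd G u ≗ lookup V∖N[v]∖u
  after-v a = trans (cong (λ t → not (a ==ᶠ v) ∧ not (t ∨ (a ==ᶠ u))) (twin a))
                    (trans (nor-merge′ (adj G v a) (a ==ᶠ v) (a ==ᶠ u)) (≡.sym (removeᵇ-full removed a)))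

  W∖v-at-u : ∀ (W : Subset n) → lookup (W [ v ]≔ false) u ≡ lookup W u
  W∖v-at-u W = lookup∘update′ u≢v W false

  W∖u-at-v : ∀ (W : Subset n) → lookup (W [ u ]≔ false) v ≡ lookup W v
  W∖u-at-v W = lookup∘update′ (≢-sym u≢v) W false

  both-in : ∀ (W : Subset n) → lookup W u ≡ true → lookup W v ≡ true →
    IsIDS G (lookup full) (lookup W) ⇔
    IsIDS G (lookup V∖N[v]∖u) (lookup ((W [ v ]≔ false) [ u ]≔ false))
  both-in W wu wv = begin
    IsIDS G (lookup full) (lookup W)
      ≈⟨ IsIDS-resp G full≗ (λ _ → refl) ⟩
    IsIDS G everything (lookup W)
      ≈⟨ pick G {w = lookup W} refl wv ⟩
    IsIDS G (everything ─ closedNbhd G v) (lookup W ─ ⦅ v ⦆)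
      ≈⟨ pick G {w = lookup W ─ ⦅ v ⦆}
                (─-intro {s = everything} {closedNbhd G v} refl (∨-false adj-vu (==ᶠ-false u≢v)))
                (─-intro {s = lookup W} {⦅ v ⦆} wu (==ᶠ-false u≢v)) ⟩
    IsIDS G ((everything ─ closedNbhd G v) ─ closedNbhd G u) ((lookup W ─ ⦅ v ⦆) ─ ⦅ u ⦆)
      ≈⟨ IsIDS-resp G after-both removed-both ⟩
    IsIDS G (lookup V∖N[v]∖u) (lookup ((W [ v ]≔ false) [ u ]≔ false)) ∎
    where
    open ⇔-Reasoning
    removed-both : (lookup W ─ ⦅ v ⦆) ─ ⦅ u ⦆ ≗ lookup ((W [ v ]≔ false) [ u ]≔ false)
    removed-both a = ≡.sym (trans (remove-lookup (W [ v ]≔ false) u a)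
                                  (cong (λ b → b ∧ not (a ==ᶠ u)) (remove-lookup W v a)))

  u-in : ∀ (W : Subset n) → lookup W u ≡ true →
    IsIDS G (lookup V∖v) (lookup W) ⇔ IsIDS G (lookup V∖N[v]∖u) (lookup (W [ u ]≔ false))
  u-in W wu = begin
    IsIDS G (lookup V∖v) (lookup W)
      ≈⟨ IsIDS-resp G (removeᵇ-full ⦅ v ⦆) (λ _ → refl) ⟩
    IsIDS G (everything ─ ⦅ v ⦆) (lookup W)
      ≈⟨ pick G {w = lookup W} (─-intro {s = everything} {⦅ v ⦆} {u} refl (==ᶠ-false u≢v)) wu ⟩
    IsIDS G ((everything ─ ⦅ v ⦆) ─ closedNbhd G u) (lookup W ─ ⦅ u ⦆)
      ≈⟨ IsIDS-resp G after-v (≡.sym ∘ remove-lookup W u) ⟩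
    IsIDS G (lookup V∖N[v]∖u) (lookup (W [ u ]≔ false)) ∎
    where open ⇔-Reasoning

  neither-in : ∀ (W : Subset n) → lookup W u ≡ false → lookup W v ≡ false →
    IsIDS G (lookup full) (lookup W) ⇔ IsIDS G (lookup V∖v) (lookup W)
  neither-in W wu wv = begin
    IsIDS G (lookup full) (lookup W)
      ≈⟨ IsIDS-resp G full≗ (λ _ → refl) ⟩
    IsIDS G everything (lookup W)
      ≈⟨ drop-twin G twin u≢v refl wu wv ⟩
    IsIDS G (everything ─ ⦅ v ⦆) (lookup W)
      ≈⟨ IsIDS-resp G (≡.sym ∘ removeᵇ-full ⦅ v ⦆) (λ _ → refl) ⟩
    IsIDS G (lookup V∖v) (lookup W) ∎
    where open ⇔-Reasoning

  v-without-u : ∀ (W : Subset n) → lookup W u ≡ false → lookup W v ≡ true →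
    ¬ IsIDS G (lookup full) (lookup W)
  v-without-u W wu wv P = clash (twin-forced G twin P (full≗ _) wv) wu

  u-without-v : ∀ (W : Subset n) → lookup W u ≡ true → lookup W v ≡ false →
    ¬ IsIDS G (lookup full) (lookup W)
  u-without-v W wu wv P = clash (twin-forced G (≡.sym ∘ twin) P (full≗ _) wu) wv

  module Counting (x : ℤ) where
    open ≡-Reasoning

    T : Subset n → Subset n → ℤ
    T = term G x

    scaledH : ℕ → Subset n → ℤ
    scaledH k W = x ^ k * T V∖N[v]∖u W

    scaledH-outside : ∀ k W i → lookup W i ≡ true → lookup V∖N[v]∖u i ≡ false → scaledH k W ≡ 0ℤ
    scaledH-outside k W = scaled-outside G x (x ^ k) V∖N[v]∖u W

    -- The terms of x · ID(G - N[v] - u) and x² · ID(G - N[v] - u), reindexed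
    -- by W ∋ u (resp. W ∋ u, v) via W ↦ W ∖ {u} (resp. W ↦ W ∖ {v, u}).
    B A′ A : Subset n → ℤ
    B  = withVertex u (scaledH 1)
    A′ = withVertex u (scaledH 2)
    A  = withVertex v A′

    Agree : Subset n → Set
    Agree W = T full W + B W ≡ T V∖v W + A W

    both-case : ∀ W → lookup W u ≡ true → lookup W v ≡ true → Agree W
    both-case W wu wv = begin
      T full W + B W
        ≡⟨ cong₂ _+_ (term-transfer G x 2 {full} {V∖N[v]∖u} {W} {W∖v∖u} (both-in W wu wv) size)
                     (trans (withVertex-in u (scaledH 1) W wu)
                            (scaledH-outside 1 (W [ u ]≔ false) v (trans (W∖u-at-v W) wv) v∉V∖N[v]∖u)) ⟩
      x ^ 2 * T V∖N[v]∖u W∖v∖u + 0ℤ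
        ≡⟨ ℤ.+-comm (x ^ 2 * T V∖N[v]∖u W∖v∖u) 0ℤ ⟩
      0ℤ + x ^ 2 * T V∖N[v]∖u W∖v∖u
        ≡⟨ ≡.sym (cong₂ _+_ (term-outside G x V∖v W v wv v∉V∖v)
                            (trans (withVertex-in v A′ W wv)
                                   (withVertex-in u (scaledH 2) (W [ v ]≔ false) (trans (W∖v-at-u W) wu)))) ⟩
      T V∖v W + A W ∎
      where
      W∖v∖u = (W [ v ]≔ false) [ u ]≔ false
      size : ∣ W ∣ ≡ 2 ℕ.+ ∣ W∖v∖u ∣
      size = trans (card-remove W v wv) (cong ℕ.suc (card-remove (W [ v ]≔ false) u (trans (W∖v-at-u W) wu)))

    u-case : ∀ W → lookup W u ≡ true → lookup W v ≡ false → Agree W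
    u-case W wu wv = begin
      T full W + B W
        ≡⟨ cong₂ _+_ (term-vanish G x full W (u-without-v W wu wv)) (withVertex-in u (scaledH 1) W wu) ⟩
      0ℤ + x ^ 1 * T V∖N[v]∖u (W [ u ]≔ false)
        ≡⟨ cong (0ℤ +_) (≡.sym (term-transfer G x 1 {V∖v} {V∖N[v]∖u} {W} {W [ u ]≔ false}
                                                (u-in W wu) (card-remove W u wu))) ⟩
      0ℤ + T V∖v W
        ≡⟨ ℤ.+-comm 0ℤ (T V∖v W) ⟩
      T V∖v W + 0ℤ
        ≡⟨ cong (T V∖v W +_) (≡.sym (withVertex-out v A′ W wv)) ⟩
      T V∖v W + A W ∎

    v-case : ∀ W → lookup W u ≡ false → lookup W v ≡ true → Agree W
    v-case W wu wv = begin
      T full W + B W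
        ≡⟨ cong₂ _+_ (term-vanish G x full W (v-without-u W wu wv)) (withVertex-out u (scaledH 1) W wu) ⟩
      0ℤ + 0ℤ
        ≡⟨ ≡.sym (cong₂ _+_ (term-outside G x V∖v W v wv v∉V∖v)
                            (trans (withVertex-in v A′ W wv)
                                   (withVertex-out u (scaledH 2) (W [ v ]≔ false) (trans (W∖v-at-u W) wu)))) ⟩
      T V∖v W + A W ∎

    neither-case : ∀ W → lookup W u ≡ false → lookup W v ≡ false → Agree W
    neither-case W wu wv =
      cong₂ _+_ (term-resp G x {full} {V∖v} {W} (neither-in W wu wv))
                (trans (withVertex-out u (scaledH 1) W wu) (≡.sym (withVertex-out v A′ W wv)))

    pointwise : ∀ W → Agree W
    pointwise W = by-membership (lookup W u) (lookup W v) refl refl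
      where
      by-membership : ∀ bu bv → lookup W u ≡ bu → lookup W v ≡ bv → Agree W
      by-membership true  true  = both-case W
      by-membership true  false = u-case W
      by-membership false true  = v-case W
      by-membership false false = neither-case W

    ΣB : Σˢ B ≡ x ^ 1 * ID G V∖N[v]∖u x
    ΣB = trans (Σˢ-withVertex u _ (λ W wu → scaledH-outside 1 W u wu u∉V∖N[v]∖u))
               (sum-map-scale (x ^ 1) (T V∖N[v]∖u) (allSubsets n))

    ΣA : Σˢ A ≡ x ^ 2 * ID G V∖N[v]∖u x
    ΣA = trans (Σˢ-withVertex v _ without-v)
        (trans (Σˢ-withVertex u _ (λ W wu → scaledH-outside 2 W u wu u∉V∖N[v]∖u))
               (sum-map-scale (x ^ 2) (T V∖N[v]∖u) (allSubsets n)))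
      where
      without-v : ∀ W → lookup W v ≡ true → A′ W ≡ 0ℤ
      without-v W wv = by-u (lookup W u) refl
        where
        by-u : ∀ b → lookup W u ≡ b → A′ W ≡ 0ℤ
        by-u true  wu = trans (withVertex-in u (scaledH 2) W wu)
                              (scaledH-outside 2 (W [ u ]≔ false) v (trans (W∖u-at-v W) wv) v∉V∖N[v]∖u)
        by-u false wu = withVertex-out u (scaledH 2) W wu

    recurrence : ID G full x + x ^ 1 * ID G V∖N[v]∖u x ≡ ID G V∖v x + x ^ 2 * ID G V∖N[v]∖u x
    recurrence = begin
      ID G full x + x ^ 1 * ID G V∖N[v]∖u x   ≡⟨ cong (ID G full x +_) (≡.sym ΣB) ⟩
      Σˢ (T full) + Σˢ B                      ≡⟨ ≡.sym (sum-map-+ (T full) B (allSubsets n)) ⟩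
      Σˢ (λ W → T full W + B W)               ≡⟨ Σˢ-cong pointwise ⟩
      Σˢ (λ W → T V∖v W + A W)                ≡⟨ sum-map-+ (T V∖v) A (allSubsets n) ⟩
      Σˢ (T V∖v) + Σˢ A                       ≡⟨ cong (Σˢ (T V∖v) +_) ΣA ⟩
      ID G V∖v x + x ^ 2 * ID G V∖N[v]∖u x ∎

cancel : ∀ (a b h x : ℤ) → a + x ^ 1 * h ≡ b + x ^ 2 * h → a ≡ b + (x ^ 2 - x) * h
cancel a b h x e = trans (add-sub a h x) (trans (cong (_+ - (x * 1ℤ * h)) e) (regroup b h x))
  where
  add-sub : ∀ (a h x : ℤ) → a ≡ (a + x * 1ℤ * h) + - (x * 1ℤ * h)
  add-sub = solve-∀
  regroup : ∀ (b h x : ℤ) → (b + x * (x * 1ℤ) * h) + - (x * 1ℤ * h) ≡ b + (x * (x * 1ℤ) + - x) * h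
  regroup = solve-∀

mainTheorem13 : {n : ℕ} (G : Graph n) (u v : Fin n) →
    ¬ (u ≡ v) →
    (∀ w → adj G u w ≡ adj G v w) →
    (x : ℤ) →
    ID G full x ≡ ID G (deleteV full v) x
                  + (x ^ 2 - x) * ID G (deleteNbV G full v u) x
mainTheorem13 G u v u≢v twin x =
  cancel (ID G full x) (ID G (deleteV full v) x) (ID G (deleteNbV G full v u) x) x
    (TwinRecurrence.Counting.recurrence G u≢v twin x)
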